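{- Let $k$, $p$ and $q$ be nonnegative integers with $k > p > 0$. Let $n_0$ be an integer with $\binom{n_0}{k} \le q < \binom{n_0+1}{k}$ and set $m_0 = q - \binom{n_0}{k}$. For $i \ge 1$ define recursively: if $m_{i-1} = 0$, set $z = i-1$ and stop; if $m_{i-1} > 0$, let $n_i$ be the unique integer with $\binom{n_i}{k-1} \le m_{i-1} < \binom{n_i+1}{k-1}$ and set $m_i = m_{i-1} - \binom{n_i}{k-1}$. Thus $$q = \binom{n_0}{k} + \binom{n_1}{k-1} + \binom{n_2}{k-1} + \dots + \binom{n_z}{k-1}.$$ Let $m = \binom{n_2}{k-1} + \dots + \binom{n_z}{k-1}$ (an empty sum being $0$). Then $$c_p^k(m) = \binom{n_2}{p-1} + \dots + \binom{n_z}{p-1}.$$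
   Context: Binomial coefficients follow the convention $\binom{n}{j} = 0$ if $n < j$. For integers $k > p \ge 1$ and an integer $m > 0$, $g_k(m)$ denotes the unique integer such that $\binom{g_k(m)}{k-1} \le m < \binom{g_k(m)+1}{k-1}$. The function $c_p^k$ is defined on integers $m \ge 0$ recursively by $c_p^k(0) = 0$ and $c_p^k(m) = \binom{g_k(m)}{p-1} + c_p^k\!\left(m - \binom{g_k(m)}{k-1}\right)$ for $m > 0$. -}

module Defs where

open import Data.Nat using (ℕ; zero; suc; _+_; _∸_; _≤_; _<_; _≤?_)
open import Data.Nat.Combinatorics using (_C_)
open import Data.List using (List; []; _∷_)
open import Relation.Nullary.Decidable using (does)
open import Data.Bool using (if_then_else_)

gSearch : ℕ → ℕ → ℕ → ℕ
gSearch k m zero    = zero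
gSearch k m (suc b) =
  if does ((suc b) C (k ∸ 1) ≤? m) then suc b else gSearch k m b

-- g_k(m): the unique n with  n C (k-1) ≤ m < (n+1) C (k-1)  (for k ≥ 2, m > 0).
-- Since (m + k) C (k-1) > m for m ≥ 1, and n ↦ n C (k-1) is monotone,
-- the largest n ≤ m + k with n C (k-1) ≤ m is exactly that n.
g : ℕ → ℕ → ℕ
g k m = gSearch k m (m + k)

-- c_p^k with fuel (the recursion decreases m strictly, so fuel m+1 suffices).
cFuel : ℕ → ℕ → ℕ → ℕ → ℕ
cFuel k p zero     m       = zero
cFuel k p (suc f)  zero    = zero
cFuel k p (suc f)  (suc m) =
  (g k (suc m)) C (p ∸ 1) + cFuel k p f (suc m ∸ (g k (suc m)) C (k ∸ 1))

-- c_p^k(0) = 0,  c_p^k(m) = C(g_k(m), p-1) + c_p^k(m - C(g_k(m), k-1)).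
c : ℕ → ℕ → ℕ → ℕ
c k p m = cFuel k p (suc m) m

data Greedy (k : ℕ) : ℕ → List ℕ → Set where
  stop : Greedy k zero []
  step : ∀ {m n ns} → 0 < m →
         n C (k ∸ 1) ≤ m → m < (suc n) C (k ∸ 1) →
         Greedy k (m ∸ n C (k ∸ 1)) ns →
         Greedy k m (n ∷ ns)

module Submission where

-- The greedy
-- recursion that produced n₁, n₂, …, n_z from q − C(n₀,k) continues, after its
-- first step, from m₁ = m; so [n₂, …, n_z] is the greedy sequence of m itself.
-- The recursion defining c_p^k(m) is exactly that greedy recursion: at each
-- step it picks g_k(mᵢ), which is the unique n with C(n,k-1) ≤ mᵢ < C(n+1,k-1),
-- adds C(n,p-1) and continues with mᵢ − C(n,k-1).  Hence c_p^k(m) collects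
-- C(n,p-1) over the greedy sequence of m.
--
-- Neither these facts nor the theorem need the hypotheses k > p > 0 or the
-- bounds on n₀; they hold for all k and p.

open import Defs
open import Data.Nat using (ℕ; zero; suc; _+_; _∸_; _≤_; _<_; _≤′_; ≤′-refl; ≤′-step; _≤?_; z≤n; s≤s)
open import Data.Nat.Properties
open import Data.Nat.Combinatorics using (_C_; nCk+nC[k+1]≡[n+1]C[k+1]; nCn≡1)
open import Data.Nat.Combinatorics.Specification using (k>n⇒nCk≡0)
open import Data.List using (List; []; _∷_; map; drop)
open import Data.Nat.ListAction using (sum)
open import Relation.Binary.PropositionalEquality
open import Relation.Nullary using (yes; no; ¬_; Dec; contradiction)
open import Relation.Nullary.Decidable using (does)
open import Data.Bool using (if_then_else_)
open import Data.Sum using (inj₁; inj₂)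

sumC : ℕ → List ℕ → ℕ
sumC j ns = sum (map (λ n → n C j) ns)

C-positive : ∀ n j → j ≤ n → 0 < n C j
C-positive n       zero    _         = s≤s z≤n
C-positive (suc n) (suc j) (s≤s j≤n) =
  subst (0 <_) (nCk+nC[k+1]≡[n+1]C[k+1] n j)
        (<-≤-trans (C-positive n j j≤n) (m≤m+n _ _))

C-atMostOne : ∀ n j → n ≤ j → n C j ≤ 1
C-atMostOne n j n≤j with m≤n⇒m<n∨m≡n n≤j
... | inj₁ n<j  = ≤-trans (≤-reflexive (k>n⇒nCk≡0 n<j)) z≤n
... | inj₂ refl = ≤-reflexive (nCn≡1 n)

C-monoStep : ∀ n j → n C j ≤ suc n C j
C-monoStep n zero    = ≤-refl
C-monoStep n (suc j) =
  subst (n C suc j ≤_) (nCk+nC[k+1]≡[n+1]C[k+1] n j) (m≤n+m _ _)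

C-mono : ∀ {a b} j → a ≤ b → a C j ≤ b C j
C-mono j a≤b = go (≤⇒≤′ a≤b)
  where
  go : ∀ {a b} → a ≤′ b → a C j ≤ b C j
  go ≤′-refl = ≤-refl
  go (≤′-step {n} a≤′n) = ≤-trans (go a≤′n) (C-monoStep n j)

-- C(n, j+1) grows at least like n − j; this bounds the range g has to search.
C-growth : ∀ n j → n ≤ n C suc j + j
C-growth zero    j = z≤n
C-growth (suc n) j with j ≤? n
... | yes j≤n = begin
      suc n                     ≤⟨ s≤s (C-growth n j) ⟩
      suc (n C suc j + j)       ≤⟨ +-monoˡ-≤ j (+-monoˡ-≤ (n C suc j) (C-positive n j j≤n)) ⟩
      (n C j + n C suc j) + j   ≡⟨ cong (_+ j) (nCk+nC[k+1]≡[n+1]C[k+1] n j) ⟩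
      suc n C suc j + j         ∎
  where open ≤-Reasoning
... | no j≰n = ≤-trans (≰⇒> j≰n) (m≤n+m j _)

-- If 0 < m < C(n+1,j) then C(n,j) > 0 (otherwise n < j and C(n+1,j) ≤ 1);
-- this is why each greedy step strictly decreases m.
bracket-positive : ∀ {m} n j → 0 < m → m < suc n C j → 0 < n C j
bracket-positive n j 0<m m<C with j ≤? n
... | yes j≤n = C-positive n j j≤n
... | no j≰n  = contradiction (≤-trans m<C (C-atMostOne (suc n) j (≰⇒> j≰n))) (<⇒≱ (s≤s 0<m))

if-yes : ∀ {P : Set} {x y : ℕ} (d : Dec P) → P → (if does d then x else y) ≡ x
if-yes (yes _) _ = refl
if-yes (no ¬p) p = contradiction p ¬p

if-no : ∀ {P : Set} {x y : ℕ} (d : Dec P) → ¬ P → (if does d then x else y) ≡ y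
if-no (yes p) ¬p = contradiction p ¬p
if-no (no _)  _  = refl

-- The downward search for the largest admissible index finds the bracketing
-- index n of m, provided it starts at or above n: every b > n has
-- C(b,k-1) ≥ C(n+1,k-1) > m and is rejected, and n itself is accepted.
gSearch-bracket : ∀ {k m n} b → n C (k ∸ 1) ≤ m → m < suc n C (k ∸ 1) → n ≤ b →
                  gSearch k m b ≡ n
gSearch-bracket {n = zero}  zero    _  _  _  = refl
gSearch-bracket {k} {m} {n} (suc b) lo hi n≤b with n ≟ suc b
... | yes refl = if-yes (suc b C (k ∸ 1) ≤? m) lo
... | no n≢b   = trans (if-no (suc b C (k ∸ 1) ≤? m) rejected)
                       (gSearch-bracket b lo hi (≤-pred n<b))
  where
  n<b : n < suc b
  n<b = ≤∧≢⇒< n≤b n≢b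
  rejected : ¬ (suc b C (k ∸ 1) ≤ m)
  rejected accepted = <⇒≱ hi (≤-trans (C-mono (k ∸ 1) n<b) accepted)

g-bracket : ∀ {k m n} → n C (k ∸ 1) ≤ m → m < suc n C (k ∸ 1) → g k m ≡ n
g-bracket {zero}          lo hi = contradiction lo (<⇒≱ hi)
g-bracket {suc zero}      lo hi = contradiction lo (<⇒≱ hi)
g-bracket {suc (suc j)} {m} {n} lo hi = gSearch-bracket (m + suc (suc j)) lo hi inRange
  where
  inRange : n ≤ m + suc (suc j)
  inRange = ≤-trans (C-growth n j) (+-mono-≤ lo (≤-trans (n≤1+n j) (n≤1+n (suc j))))

greedy-sum : ∀ {k m ns} → Greedy k m ns → m ≡ sumC (k ∸ 1) ns
greedy-sum stop = refl
greedy-sum {k} {m} {n ∷ ns} (step _ lo _ gr) = begin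
  m                                  ≡⟨ m∸n+n≡m lo ⟨
  m ∸ n C (k ∸ 1) + n C (k ∸ 1)      ≡⟨ +-comm _ (n C (k ∸ 1)) ⟩
  n C (k ∸ 1) + (m ∸ n C (k ∸ 1))    ≡⟨ cong (n C (k ∸ 1) +_) (greedy-sum gr) ⟩
  n C (k ∸ 1) + sumC (k ∸ 1) ns      ∎
  where open ≡-Reasoning

cFuel-greedy : ∀ {k p m ns} → Greedy k m ns → ∀ f → m < f →
               cFuel k p f m ≡ sumC (p ∸ 1) ns
cFuel-greedy stop (suc f) _ = refl
cFuel-greedy {k} {p} {suc m} {n ∷ ns} (step 0<m lo hi gr) (suc f) (s≤s m<f) = begin
  g k (suc m) C (p ∸ 1) + cFuel k p f (suc m ∸ g k (suc m) C (k ∸ 1))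
    ≡⟨ cong (λ x → x C (p ∸ 1) + cFuel k p f (suc m ∸ x C (k ∸ 1))) (g-bracket lo hi) ⟩
  n C (p ∸ 1) + cFuel k p f (suc m ∸ n C (k ∸ 1))
    ≡⟨ cong (n C (p ∸ 1) +_) (cFuel-greedy gr f enoughFuel) ⟩
  n C (p ∸ 1) + sumC (p ∸ 1) ns ∎
  where
  open ≡-Reasoning
  enoughFuel : suc m ∸ n C (k ∸ 1) < f
  enoughFuel = ≤-trans (∸-monoʳ-< (bracket-positive n (k ∸ 1) 0<m hi) lo) m<f

c-greedy : ∀ {k p m ns} → Greedy k m ns → c k p m ≡ sumC (p ∸ 1) ns
c-greedy gr = cFuel-greedy gr _ ≤-refl

-- The tail [n₂, …, n_z] is the greedy sequence of m₁, which equals the sum m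
-- of its terms; so c_p^k(m) = c_p^k(m₁) = Σ C(nᵢ, p-1).
lemma2p5 : (k p q n₀ : ℕ) (ns : List ℕ) →
    0 < p → p < k →
    n₀ C k ≤ q → q < (suc n₀) C k →
    Greedy k (q ∸ n₀ C k) ns →
    c k p (sum (map (λ n → n C (k ∸ 1)) (drop 1 ns)))
      ≡ sum (map (λ n → n C (p ∸ 1)) (drop 1 ns))
lemma2p5 k p q n₀ []       _ _ _ _ _ = refl
lemma2p5 k p q n₀ (_ ∷ ns) _ _ _ _ (step {m₀} {n₁} _ _ _ tail) = begin
  c k p (sumC (k ∸ 1) ns)            ≡⟨ cong (c k p) (greedy-sum tail) ⟨
  c k p (m₀ ∸ n₁ C (k ∸ 1))          ≡⟨ c-greedy tail ⟩
  sumC (p ∸ 1) ns                    ∎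
  where open ≡-Reasoning
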